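{- Let $\alpha\ge1$, $\beta\ge1$ be integers, $u=\max\{\alpha,\beta\}$, $n\ge1$, and $V=(v_0<\dots<v_{n-1})$ a sorted array. For every $x\in V$, the total cost of the comparisons performed by the $(\alpha,\beta)$ Fibonacci search algorithm on input $V,x$ (equivalently, the level of the implicit $(\alpha,\beta)$ decision tree of the algorithm) is at most $u\cdot\lceil\log_2 n\rceil$.
   Context: Let $\ell=\min\{\alpha,\beta\}$. Define $g(k)=0$ for $k<0$, $g(0)=1$, $g(k)=g(k-\alpha)+g(k-\beta)$ for $k\ge1$, and $G(k)=\sum_{i=1}^{\ell} g(k+1-i)$. Setting: $x$ equals one of the items of $V$; a comparison "$x\le v_j$?" costs $\alpha$ if true and $\beta$ if false. The $(\alpha,\beta)$ Fibonacci search algorithm: compute $G$ up to $k=\min\{j\ge0: G(j)\ge n\}$; set $z=k-\alpha$, $left=0$, $right=n-1$; while $left<right$: set $index=\min(left+G(z)-1,\,right)$, compare $x\le v_{index}$; if true set $right=index$ and $z=z-\alpha$, otherwise set $left=index+1$ and $z=z-\beta$. On exit the output position is $left$. The level of the implicit decision tree is the maximum, over $x\in V$, of the total comparison cost. -}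

module Defs where

open import Data.Nat as ℕ using (ℕ; zero; suc; _<?_; _≤?_)
open import Data.Integer as ℤ using (ℤ; +_; -[1+_]; _⊓_)
open import Data.Fin using (Fin; fromℕ<)
open import Data.Maybe using (Maybe; just; nothing)
open import Relation.Nullary using (yes; no)

-- g(k) = 0 for k < 0, g(0) = 1, g(k) = g(k-α) + g(k-β) for k ≥ 1.
-- Implemented with fuel; under α, β ≥ 1 (assumed in the theorem) every
-- recursive call strictly decreases k, so fuel ∣k∣+1 is always enough.
gF : ℕ → ℕ → ℕ → ℤ → ℕ
gF α β zero    _            = 0
gF α β (suc f) -[1+ _ ]     = 0
gF α β (suc f) (+ zero)     = 1
gF α β (suc f) (+ suc m)    =
  gF α β f (+ suc m ℤ.- + α) ℕ.+ gF α β f (+ suc m ℤ.- + β)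

g : ℕ → ℕ → ℤ → ℕ
g α β k = gF α β (suc ℤ.∣ k ∣) k

Gsum : ℕ → ℕ → ℤ → ℕ → ℕ
Gsum α β k zero    = 0
Gsum α β k (suc i) = g α β (k ℤ.+ + 1 ℤ.- + suc i) ℕ.+ Gsum α β k i

G : ℕ → ℕ → ℤ → ℕ
G α β k = Gsum α β k (α ℕ.⊓ β)

at : {n : ℕ} → (Fin n → ℕ) → ℕ → Maybe ℕ
at {n} v i with i <? n
... | yes p = just (v (fromℕ< p))
... | no _  = nothing

-- The while loop of the (α,β) Fibonacci search, with fuel.
-- run α β v x fuel left right z  returns  just c  if the loop exits
-- (left ≥ right) within the fuel, with c the total cost of the
-- comparisons performed; nothing if the fuel runs out or an invalid
-- index (negative / ≥ n) would be accessed.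
run : (α β : ℕ) {n : ℕ} → (Fin n → ℕ) → ℕ → ℕ → ℕ → ℕ → ℤ → Maybe ℕ
run α β v x zero    left right z = nothing
run α β v x (suc f) left right z with left <? right
... | no  _ = just 0
... | yes _ with (+ left ℤ.+ + G α β z ℤ.- + 1) ⊓ + right
...   | -[1+ _ ] = nothing
...   | + index with at v index
...     | nothing = nothing
...     | just w with x ≤? w
...       | yes _ = Data.Maybe.map (α ℕ.+_) (run α β v x f left index (z ℤ.- + α))
...       | no  _ = Data.Maybe.map (β ℕ.+_) (run α β v x f (suc index) right (z ℤ.- + β))

-- The loop state (left, right, z) is read as "node w = z + α of the decision
-- tree".  The invariant is: p ∈ [left, right] and the window has at most G(w)
-- elements.  A comparison costing a ∈ {α, β} moves to node w - a and, because
-- G(w) = G(w-α) + G(w-β), the chosen part of the window fits the new node; a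
-- window of two or more elements forces w ≥ α, so the loop runs only at such
-- nodes.  Hence the total cost is at most the start node k.  Finally G grows
-- exponentially, G(u·m) ≥ 2^m for u = max(α,β), so the minimal k with
-- G(k) ≥ n satisfies k ≤ u·⌈log₂ n⌉.
module Submission where

open import Defs
open import Data.Nat using (ℕ; _≤_; _<_; _⊔_; _*_; _∸_)
open import Data.Nat.Logarithm using (⌈log₂_⌉)
open import Data.Integer using (+_; _-_)
open import Data.Fin as Fin using (Fin)
open import Data.Maybe using (just)
open import Data.Product using (∃-syntax; _×_)
open import Relation.Binary.PropositionalEquality using (_≡_)

open import Data.Nat using (zero; suc; _+_; _⊓_; _^_; z≤n; s≤s; s≤s⁻¹; _<?_; _≤?_; ⌈_/2⌉)
open import Data.Nat.Properties
open import Data.Nat.Induction using (<-rec)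
open import Data.Nat.Logarithm.Core using (⌈log2⌉)
open import Induction.WellFounded using (Acc; acc)
open import Algebra.Properties.CommutativeSemigroup +-commutativeSemigroup using (interchange)
open import Data.Integer as ℤ using (ℤ; -[1+_])
import Data.Integer.Properties as ℤP
open import Data.Integer.Tactic.RingSolver using (solve-∀)
open import Data.Fin using (toℕ; fromℕ<)
import Data.Fin.Properties as FinP
open import Data.Maybe using (Maybe; map)
open import Data.Product using (_,_)
open import Data.Sum using (inj₁; inj₂)
open import Relation.Nullary using (Dec; yes; no; ¬_)
open import Relation.Nullary.Negation using (contradiction)
open import Relation.Binary.Definitions using (tri<; tri≈; tri>)
open import Relation.Binary.PropositionalEquality
  using (refl; sym; trans; cong; cong₂; subst; module ≡-Reasoning)

n≤2^⌈log₂n⌉ : ∀ n → n ≤ 2 ^ ⌈log₂ n ⌉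
n≤2^⌈log₂n⌉ n = bound n _
  where
  bound : ∀ m (rec : Acc _<_ m) → m ≤ 2 ^ ⌈log2⌉ m rec
  bound zero          _        = z≤n
  bound (suc zero)    _        = s≤s z≤n
  bound (suc (suc m)) (acc rs) = begin
      2 + m                ≤⟨ +-monoʳ-≤ 2 m≤c+c ⟩
      2 + (c + c)          ≡⟨ cong suc (sym (+-suc c c)) ⟩
      suc c + suc c        ≤⟨ +-mono-≤ half half ⟩
      2 ^ L + 2 ^ L        ≡⟨ cong (_+_ (2 ^ L)) (sym (+-identityʳ (2 ^ L))) ⟩
      2 ^ suc L            ∎
    where
    open ≤-Reasoning
    c L : ℕ
    c = ⌈ m /2⌉
    L = ⌈log2⌉ (suc c) (rs (⌈n/2⌉<n m))
    half : suc c ≤ 2 ^ L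
    half = bound (suc c) _
    m≤c+c : m ≤ c + c
    m≤c+c = subst (_≤ c + c) (⌊n/2⌋+⌈n/2⌉≡n m) (+-monoˡ-≤ c (⌊n/2⌋≤⌈n/2⌉ m))

+-∸ : ∀ {m a} → a ≤ m → + m - + a ≡ + (m ∸ a)
+-∸ {m} {a} a≤m = trans (ℤP.m-n≡m⊖n m a) (ℤP.⊖-≥ a≤m)

+-<0 : ∀ {m a} → m < a → + m - + a ℤ.< + 0
+-<0 {m} {a} m<a
  rewrite ℤP.m-n≡m⊖n m a | ℤP.⊖-< m<a | sym (m+[n∸m]≡n {1} (m<n⇒0<n∸m m<a)) = ℤ.-<+

1+m-a≤m : ∀ m {a} → 1 ≤ a → + suc m - + a ℤ.≤ + m
1+m-a≤m m {a} 1≤a = subst (ℤ._≤ + m) (sym (ℤP.m-n≡m⊖n (suc m) a)) (ℤP.⊖-monoʳ-≥-≤ (suc m) 1≤a)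

summand-index : ∀ k i → k ℤ.+ + 1 - + suc i ≡ k - + i
summand-index k i = shift k (+ i)
  where
  shift : ∀ (k j : ℤ) → k ℤ.+ + 1 - (+ 1 ℤ.+ j) ≡ k - j
  shift = solve-∀

shifted-summand-index : ∀ k a i → (k - a) ℤ.+ + 1 - + suc i ≡ (k - + i) - a
shifted-summand-index k a i = shift k a (+ i)
  where
  shift : ∀ (k a j : ℤ) → (k - a) ℤ.+ + 1 - (+ 1 ℤ.+ j) ≡ (k - j) - a
  shift = solve-∀

sub-comm : ∀ (k a b : ℤ) → (k - a) - b ≡ (k - b) - a
sub-comm = solve-∀

module Fibonacci (α β : ℕ) (1≤α : 1 ≤ α) (1≤β : 1 ≤ β) where

  ℓ u : ℕ
  ℓ = α ⊓ β
  u = α ⊔ β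

  gF-fuel : ∀ f f' k → k ℤ.< + f → k ℤ.< + f' → gF α β f k ≡ gF α β f' k
  gF-fuel zero       zero       k          _ _ = refl
  gF-fuel zero       (suc f')   -[1+ _ ]   _ _ = refl
  gF-fuel (suc f)    zero       -[1+ _ ]   _ _ = refl
  gF-fuel (suc f)    (suc f')   -[1+ _ ]   _ _ = refl
  gF-fuel (suc f)    (suc f')   (+ zero)   _ _ = refl
  gF-fuel (suc f)    (suc f')   (+ suc m) (ℤ.+<+ (s≤s m<f)) (ℤ.+<+ (s≤s m<f')) =
    cong₂ _+_ (gF-fuel f f' _ (below 1≤α m<f) (below 1≤α m<f'))
              (gF-fuel f f' _ (below 1≤β m<f) (below 1≤β m<f'))
    where
    below : ∀ {a h} → 1 ≤ a → m < h → + suc m - + a ℤ.< + h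
    below 1≤a m<h = ℤP.≤-<-trans (1+m-a≤m m 1≤a) (ℤ.+<+ m<h)
  gF-fuel zero       _          (+ _)      (ℤ.+<+ ()) _
  gF-fuel (suc _)    zero       (+ _)      _ (ℤ.+<+ ())

  g-neg : ∀ {k} → k ℤ.< + 0 → g α β k ≡ 0
  g-neg { -[1+ _ ]} _          = refl
  g-neg {+ _}       (ℤ.+<+ ())

  g-rec : ∀ {k} → + 0 ℤ.< k → g α β k ≡ g α β (k - + α) + g α β (k - + β)
  g-rec {+ zero}  (ℤ.+<+ ())
  g-rec {+ suc m} _ = cong₂ _+_ (unfuel 1≤α) (unfuel 1≤β)
    where
    unfuel : ∀ {a} → 1 ≤ a → gF α β (suc m) (+ suc m - + a) ≡ g α β (+ suc m - + a)
    unfuel 1≤a = gF-fuel (suc m) _ _ (ℤP.≤-<-trans (1+m-a≤m m 1≤a) (ℤ.+<+ ≤-refl)) (self _)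
      where
      self : ∀ k → k ℤ.< + suc ℤ.∣ k ∣
      self (+ n)    = ℤ.+<+ ≤-refl
      self -[1+ _ ] = ℤ.-<+

  -- g vanishes on 1 .. ℓ-1: both recursive arguments are negative.
  g-gap : ∀ {m} → 1 ≤ m → m < ℓ → g α β (+ m) ≡ 0
  g-gap 1≤m m<ℓ = trans (g-rec (ℤ.+<+ 1≤m))
    (cong₂ _+_ (g-neg (+-<0 (<-≤-trans m<ℓ (m⊓n≤m α β))))
               (g-neg (+-<0 (<-≤-trans m<ℓ (m⊓n≤n α β)))))

  Gsum-rec : ∀ k m → (∀ i → i < m → + 0 ℤ.< k - + i) →
             Gsum α β k m ≡ Gsum α β (k - + α) m + Gsum α β (k - + β) m
  Gsum-rec k zero    _   = refl
  Gsum-rec k (suc m) pos = begin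
      g α β (k ℤ.+ + 1 - + suc m) + Gsum α β k m
        ≡⟨ cong₂ _+_ (trans (cong (g α β) (summand-index k m)) (g-rec (pos m ≤-refl)))
                     (Gsum-rec k m (λ i i<m → pos i (m<n⇒m<1+n i<m))) ⟩
      (g α β (k - + m - + α) + g α β (k - + m - + β)) + (Gsum α β (k - + α) m + Gsum α β (k - + β) m)
        ≡⟨ interchange (g α β (k - + m - + α)) (g α β (k - + m - + β))
                       (Gsum α β (k - + α) m) (Gsum α β (k - + β) m) ⟩
      (g α β (k - + m - + α) + Gsum α β (k - + α) m) + (g α β (k - + m - + β) + Gsum α β (k - + β) m)
        ≡⟨ sym (cong₂ (λ s t → (g α β s + Gsum α β (k - + α) m) + (g α β t + Gsum α β (k - + β) m))
                      (shifted-summand-index k (+ α) m) (shifted-summand-index k (+ β) m)) ⟩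
      Gsum α β (k - + α) (suc m) + Gsum α β (k - + β) (suc m) ∎
    where open ≡-Reasoning

  Gsum-neg : ∀ {k} m → k ℤ.< + 0 → Gsum α β k m ≡ 0
  Gsum-neg zero    _   = refl
  Gsum-neg {k} (suc m) k<0 = cong₂ _+_
    (trans (cong (g α β) (summand-index k m)) (g-neg (ℤP.≤-<-trans (ℤP.i-j≤i k (+ m)) k<0)))
    (Gsum-neg m k<0)

  -- For 0 ≤ w < ℓ the window of G(w) contains g(0) = 1 and otherwise only zeros.
  Gsum-init-below : ∀ {w} m → w < ℓ → m ≤ w → Gsum α β (+ w) m ≡ 0
  Gsum-init-below zero    _   _   = refl
  Gsum-init-below {w} (suc m) w<ℓ m<w = cong₂ _+_
    (trans (cong (g α β) (trans (summand-index (+ w) m) (+-∸ (<⇒≤ m<w))))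
           (g-gap (m<n⇒0<n∸m m<w) (≤-<-trans (m∸n≤m w m) w<ℓ)))
    (Gsum-init-below m w<ℓ (<⇒≤ m<w))

  Gsum-init-above : ∀ {w} m → w < ℓ → w < m → Gsum α β (+ w) m ≡ 1
  Gsum-init-above {w} (suc m) w<ℓ w<1+m with m≤n⇒m<n∨m≡n (s≤s⁻¹ w<1+m)
  ... | inj₁ w<m = cong₂ _+_
    (trans (cong (g α β) (summand-index (+ w) m)) (g-neg (+-<0 w<m)))
    (Gsum-init-above m w<ℓ w<m)
  ... | inj₂ refl = cong₂ _+_
    (cong (g α β) (trans (summand-index (+ w) w) (trans (+-∸ (≤-refl {w})) (cong +_ (n∸n≡0 w)))))
    (Gsum-init-below w w<ℓ ≤-refl)

  Gℕ : ℕ → ℕ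
  Gℕ w = G α β (+ w)

  Gℕ-init : ∀ {w} → w < ℓ → Gℕ w ≡ 1
  Gℕ-init w<ℓ = Gsum-init-above ℓ w<ℓ w<ℓ

  G-rec : ∀ {w} → ℓ ≤ w → Gℕ w ≡ G α β (+ w - + α) + G α β (+ w - + β)
  G-rec {w} ℓ≤w = Gsum-rec (+ w) ℓ positive
    where
    positive : ∀ i → i < ℓ → + 0 ℤ.< + w - + i
    positive i i<ℓ = subst (+ 0 ℤ.<_) (sym (+-∸ (<⇒≤ i<w))) (ℤ.+<+ (m<n⇒0<n∸m i<w))
      where
      i<w : i < w
      i<w = <-≤-trans i<ℓ ℓ≤w

  G-neg : ∀ {w a} → w < a → G α β (+ w - + a) ≡ 0
  G-neg w<a = Gsum-neg ℓ (+-<0 w<a)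

  G-shift : ∀ {w a} → a ≤ w → G α β (+ w - + a) ≡ Gℕ (w ∸ a)
  G-shift a≤w = cong (G α β) (+-∸ a≤w)

  decrease : ∀ {w a} → 1 ≤ a → a ≤ w → w ∸ a < w
  decrease 1≤a a≤w = ∸-monoʳ-< 1≤a a≤w

  -- G is positive on ℕ: for w ≥ ℓ one of the summands G(w-α), G(w-β)
  -- is G at a smaller natural number.
  Gℕ-pos : ∀ w → 1 ≤ Gℕ w
  Gℕ-pos = <-rec _ step
    where
    shifted : ∀ {w a} → 1 ≤ a → a ≤ w → (∀ {y} → y < w → 1 ≤ Gℕ y) → 1 ≤ G α β (+ w - + a)
    shifted 1≤a a≤w ih = subst (1 ≤_) (sym (G-shift a≤w)) (ih (decrease 1≤a a≤w))

    step : ∀ w → (∀ {y} → y < w → 1 ≤ Gℕ y) → 1 ≤ Gℕ w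
    step w ih with w <? ℓ | ⊓-sel α β
    ... | yes w<ℓ | _        = ≤-reflexive (sym (Gℕ-init w<ℓ))
    ... | no  w≮ℓ | inj₁ ℓ≡α = subst (1 ≤_) (sym (G-rec (≮⇒≥ w≮ℓ)))
      (≤-trans (shifted 1≤α (subst (_≤ w) ℓ≡α (≮⇒≥ w≮ℓ)) ih) (m≤m+n _ _))
    ... | no  w≮ℓ | inj₂ ℓ≡β = subst (1 ≤_) (sym (G-rec (≮⇒≥ w≮ℓ)))
      (≤-trans (shifted 1≤β (subst (_≤ w) ℓ≡β (≮⇒≥ w≮ℓ)) ih) (m≤n+m _ _))

  -- Below α only the β-branch of the recurrence survives, so G stays ≤ 1.
  Gℕ-below-α : ∀ {w} → w < α → Gℕ w ≤ 1
  Gℕ-below-α {w} = <-rec (λ w → w < α → Gℕ w ≤ 1) step w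
    where
    step : ∀ w → (∀ {y} → y < w → y < α → Gℕ y ≤ 1) → w < α → Gℕ w ≤ 1
    step w ih w<α with w <? ℓ
    ... | yes w<ℓ = ≤-reflexive (Gℕ-init w<ℓ)
    ... | no  w≮ℓ = subst (_≤ 1) (sym (trans (G-rec (≮⇒≥ w≮ℓ))
                                       (cong (λ t → t + G α β (+ w - + β)) (G-neg w<α))))
                              β-branch
      where
      β-branch : G α β (+ w - + β) ≤ 1
      β-branch with β ≤? w
      ... | yes β≤w = subst (_≤ 1) (sym (G-shift β≤w))
                        (ih (decrease 1≤β β≤w) (≤-<-trans (m∸n≤m w β) w<α))
      ... | no  β≰w = subst (_≤ 1) (sym (G-neg (≰⇒> β≰w))) z≤n

  Gℕ≥2⇒α≤w : ∀ {w} → 2 ≤ Gℕ w → α ≤ w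
  Gℕ≥2⇒α≤w {w} 2≤G with α ≤? w
  ... | yes α≤w = α≤w
  ... | no  α≰w = contradiction (Gℕ-below-α (≰⇒> α≰w)) (<⇒≱ 2≤G)

  Gℕ-exp : ∀ m {w} → u * m ≤ w → 2 ^ m ≤ Gℕ w
  Gℕ-exp zero    {w} _     = Gℕ-pos w
  Gℕ-exp (suc m) {w} um≤w = begin
      2 ^ m + (2 ^ m + 0)                          ≡⟨ cong (_+_ (2 ^ m)) (+-identityʳ (2 ^ m)) ⟩
      2 ^ m + 2 ^ m                                ≤⟨ +-mono-≤ (half (m≤m⊔n α β)) (half (m≤n⊔m α β)) ⟩
      G α β (+ w - + α) + G α β (+ w - + β)        ≡⟨ sym (G-rec (≤-trans (m⊓n≤m⊔n α β) u≤w)) ⟩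
      Gℕ w                                         ∎
    where
    open ≤-Reasoning
    u+um≤w : u + u * m ≤ w
    u+um≤w = subst (_≤ w) (*-suc u m) um≤w
    u≤w : u ≤ w
    u≤w = m+n≤o⇒m≤o u u+um≤w
    half : ∀ {a} → a ≤ u → 2 ^ m ≤ G α β (+ w - + a)
    half {a} a≤u = subst (2 ^ m ≤_) (sym (G-shift (≤-trans a≤u u≤w)))
      (Gℕ-exp m (m+n≤o⇒m≤o∸n (u * m)
        (≤-trans (+-monoʳ-≤ (u * m) a≤u) (subst (_≤ w) (+-comm u (u * m)) u+um≤w))))

  -- The first k with G(k) ≥ n satisfies k ≤ u⌈log₂ n⌉,
  -- since G(u⌈log₂ n⌉) ≥ 2^⌈log₂ n⌉ ≥ n.
  first-index-bound : ∀ n k → (∀ j → j < k → Gℕ j < n) → k ≤ u * ⌈log₂ n ⌉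
  first-index-bound n k below with k ≤? u * ⌈log₂ n ⌉
  ... | yes k≤ = k≤
  ... | no  k≰ = contradiction (below _ (≰⇒> k≰))
                   (≤⇒≯ (≤-trans (n≤2^⌈log₂n⌉ n) (Gℕ-exp ⌈log₂ n ⌉ ≤-refl)))

at-in-range : ∀ {n} (v : Fin n → ℕ) {i} (i<n : i < n) → at v i ≡ just (v (fromℕ< i<n))
at-in-range {n} v {i} i<n with i <? n
... | yes _   = refl
... | no  i≮n = contradiction i<n i≮n

-- A strictly increasing array reflects comparisons of its entries back to
-- comparisons of positions; this is how a comparison with x = v_p locates p.
module StrictlyIncreasing {n} (v : Fin n → ℕ) (increasing : ∀ i j → i Fin.< j → v i < v j) where

  reflects-≤ : ∀ i j → v i ≤ v j → toℕ i ≤ toℕ j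
  reflects-≤ i j vi≤vj with FinP.<-cmp i j
  ... | tri< i<j _ _    = <⇒≤ i<j
  ... | tri≈ _ refl _   = ≤-refl
  ... | tri> _ _ j<i    = contradiction vi≤vj (<⇒≱ (increasing j i j<i))

  reflects-< : ∀ i j → v i < v j → toℕ i < toℕ j
  reflects-< i j vi<vj with FinP.<-cmp i j
  ... | tri< i<j _ _    = i<j
  ... | tri≈ _ refl _   = contradiction vi<vj (<-irrefl refl)
  ... | tri> _ _ j<i    = contradiction vi<vj (<⇒≯ (increasing j i j<i))

-- The interval [l, r] has suc (r ∸ l) elements.  Cutting it after the first
-- A positions bounds the sizes of the two parts.
prefix-size : ∀ {l r A} → 1 ≤ A → r ≤ l + A ∸ 1 → suc (r ∸ l) ≤ A
prefix-size {l} {r} {A} 1≤A r≤ = begin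
    suc (r ∸ l)              ≤⟨ s≤s (∸-monoˡ-≤ l r≤) ⟩
    suc (l + A ∸ 1 ∸ l)      ≡⟨ cong (λ t → suc (t ∸ l)) (+-∸-assoc l 1≤A) ⟩
    suc (l + (A ∸ 1) ∸ l)    ≡⟨ cong suc (m+n∸m≡n l (A ∸ 1)) ⟩
    suc (A ∸ 1)              ≡⟨ m+[n∸m]≡n 1≤A ⟩
    A                        ∎
  where open ≤-Reasoning

suffix-size : ∀ {l r A B} → l + A ≤ r → suc (r ∸ l) ≤ A + B → suc (r ∸ (l + A)) ≤ B
suffix-size {l} {r} {A} {B} l+A≤r size≤ = begin
    suc (r ∸ (l + A))        ≡⟨ cong suc (sym (∸-+-assoc r l A)) ⟩
    suc (r ∸ l ∸ A)          ≡⟨ sym (+-∸-assoc 1 A≤r∸l) ⟩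
    suc (r ∸ l) ∸ A          ≤⟨ ∸-monoˡ-≤ A size≤ ⟩
    A + B ∸ A                ≡⟨ m+n∸m≡n A B ⟩
    B                        ∎
  where
  open ≤-Reasoning
  A≤r∸l : A ≤ r ∸ l
  A≤r∸l = subst (_≤ r ∸ l) (m+n∸m≡n l A) (∸-monoˡ-≤ l l+A≤r)

-- The state (left, right, z) is written with
-- z = w - α for a natural number w: the loop is then at node w of the
-- decision tree, and w bounds the cost still to be paid.
module Search (α β : ℕ) (1≤α : 1 ≤ α) (1≤β : 1 ≤ β) {n : ℕ} (v : Fin n → ℕ)
              (increasing : ∀ i j → i Fin.< j → v i < v j) (p : Fin n) where

  open Fibonacci α β 1≤α 1≤β
  open StrictlyIncreasing v increasing

  loop : ℕ → ℕ → ℕ → ℕ → Maybe ℕ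
  loop fuel left right w = run α β v (v p) fuel left right (+ w - + α)

  record Invariant (w left right : ℕ) : Set where
    field
      left≤p  : left ≤ toℕ p
      p≤right : toℕ p ≤ right
      right<n : right < n
      size≤G  : suc (right ∸ left) ≤ Gℕ w

  probe : ℕ → ℕ → ℕ → ℕ
  probe w left right = (left + Gℕ (w ∸ α) ∸ 1) ⊓ right

  probe-ℤ : ∀ {w} left right → α ≤ w →
            (+ left ℤ.+ + G α β (+ w - + α) - + 1) ℤ.⊓ + right ≡ + probe w left right
  probe-ℤ {w} left right α≤w rewrite G-shift α≤w =
    cong (ℤ._⊓ + right) (+-∸ (≤-trans (Gℕ-pos (w ∸ α)) (m≤n+m _ left)))

  loop-exit : ∀ {f w left right} → ¬ left < right → loop (suc f) left right w ≡ just 0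
  loop-exit {left = left} {right} l≮r with left <? right
  ... | yes l<r = contradiction l<r l≮r
  ... | no  _   = refl

  loop-yes : ∀ {f w left right} → left < right → α ≤ w → (q : probe w left right < n) →
             v p ≤ v (fromℕ< q) →
             loop (suc f) left right w ≡ map (_+_ α) (loop f left (probe w left right) (w ∸ α))
  loop-yes {f} {w} {left} {right} l<r α≤w q x≤ with left <? right
  ... | no l≮r = contradiction l<r l≮r
  ... | yes _ rewrite probe-ℤ left right α≤w | at-in-range v q with v p ≤? v (fromℕ< q)
  ...   | yes _  = cong (λ z → map (_+_ α) (run α β v (v p) f left (probe w left right) (z - + α)))
                        (+-∸ α≤w)
  ...   | no x≰ = contradiction x≤ x≰

  loop-no : ∀ {f w left right} → left < right → α ≤ w → β ≤ w → (q : probe w left right < n) →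
            ¬ v p ≤ v (fromℕ< q) →
            loop (suc f) left right w ≡ map (_+_ β) (loop f (suc (probe w left right)) right (w ∸ β))
  loop-no {f} {w} {left} {right} l<r α≤w β≤w q x≰ with left <? right
  ... | no l≮r = contradiction l<r l≮r
  ... | yes _ rewrite probe-ℤ left right α≤w | at-in-range v q with v p ≤? v (fromℕ< q)
  ...   | yes x≤ = contradiction x≤ x≰
  ...   | no _   = cong (λ z → map (_+_ β) (run α β v (v p) f (suc (probe w left right)) right z))
                        (begin
                          + w - + α - + β   ≡⟨ sub-comm (+ w) (+ α) (+ β) ⟩
                          + w - + β - + α   ≡⟨ cong (_- + α) (+-∸ β≤w) ⟩
                          + (w ∸ β) - + α   ∎)
    where open ≡-Reasoning

  -- If the probe lies left of p, it is the cut point left + G(w-α) - 1 itself,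
  -- and by G(w) = G(w-α) + G(w-β) the right part has at most G(w-β) elements.
  right-part-size : ∀ {w left right} → Invariant w left right → α ≤ w →
                    probe w left right < toℕ p →
                    suc (right ∸ suc (probe w left right)) ≤ G α β (+ w - + β)
  right-part-size {w} {left} {right} inv α≤w probe<p =
    subst (λ t → suc (right ∸ t) ≤ G α β (+ w - + β)) (sym cut)
      (suffix-size (subst (_≤ right) cut probe<right) split)
    where
    open Invariant inv
    A : ℕ
    A = Gℕ (w ∸ α)
    probe<right : probe w left right < right
    probe<right = <-≤-trans probe<p p≤right
    cut : suc (probe w left right) ≡ left + A
    cut = trans (cong suc (⊓-below probe<right))
                (m+[n∸m]≡n (≤-trans (Gℕ-pos (w ∸ α)) (m≤n+m A left)))
      where
      ⊓-below : ∀ {a b} → a ⊓ b < b → a ⊓ b ≡ a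
      ⊓-below {a} {b} a⊓b<b with ⊓-sel a b
      ... | inj₁ a⊓b≡a = a⊓b≡a
      ... | inj₂ a⊓b≡b = contradiction a⊓b≡b (<⇒≢ a⊓b<b)
    split : suc (right ∸ left) ≤ A + G α β (+ w - + β)
    split = subst (suc (right ∸ left) ≤_)
      (trans (G-rec (≤-trans (m⊓n≤m α β) α≤w)) (cong (λ t → t + G α β (+ w - + β)) (G-shift α≤w)))
      size≤G

  active⇒α≤w : ∀ {w left right} → left < right → Invariant w left right → α ≤ w
  active⇒α≤w l<r inv = Gℕ≥2⇒α≤w (≤-trans (s≤s (m<n⇒0<n∸m l<r)) (Invariant.size≤G inv))

  probe-in-range : ∀ {w left right} → Invariant w left right → probe w left right < n
  probe-in-range {right = right} inv = ≤-<-trans (m⊓n≤n _ right) (Invariant.right<n inv)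

  record Step (f w left right : ℕ) : Set where
    field
      cost      : ℕ
      1≤cost    : 1 ≤ cost
      cost≤w    : cost ≤ w
      left′     : ℕ
      right′    : ℕ
      next      : Invariant (w ∸ cost) left′ right′
      unfolds   : loop (suc f) left right w ≡ map (_+_ cost) (loop f left′ right′ (w ∸ cost))

  step : ∀ f {w left right} → left < right → Invariant w left right → Step f w left right
  step f {w} {left} {right} l<r inv = compare (v p ≤? v (fromℕ< probe<n))
    where
    open Invariant inv
    α≤w : α ≤ w
    α≤w = active⇒α≤w l<r inv
    probe<n : probe w left right < n
    probe<n = probe-in-range inv
    probe<p : ¬ v p ≤ v (fromℕ< probe<n) → probe w left right < toℕ p
    probe<p x≰ = subst (_< toℕ p) (FinP.toℕ-fromℕ< probe<n) (reflects-< _ p (≰⇒> x≰))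

    compare : Dec (v p ≤ v (fromℕ< probe<n)) → Step f w left right
    compare (yes x≤) = record
      { cost = α ; 1≤cost = 1≤α ; cost≤w = α≤w ; left′ = left ; right′ = probe w left right
      ; next = record
          { left≤p = left≤p
          ; p≤right = subst (toℕ p ≤_) (FinP.toℕ-fromℕ< probe<n) (reflects-≤ p _ x≤)
          ; right<n = probe<n
          ; size≤G = prefix-size {l = left} (Gℕ-pos (w ∸ α)) (m⊓n≤m _ right) }
      ; unfolds = loop-yes l<r α≤w probe<n x≤ }
    -- x > v_probe: continue in [probe + 1, right] at node w - β, which
    -- exists because otherwise that nonempty part would have size ≤ G(w-β) = 0
    compare (no x≰) with β ≤? w
    ... | no β≰w = contradiction (subst (suc (right ∸ suc (probe w left right)) ≤_)
                                        (G-neg (≰⇒> β≰w)) (right-part-size inv α≤w (probe<p x≰)))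
                                 λ ()
    ... | yes β≤w = record
      { cost = β ; 1≤cost = 1≤β ; cost≤w = β≤w ; left′ = suc (probe w left right) ; right′ = right
      ; next = record
          { left≤p = probe<p x≰
          ; p≤right = p≤right
          ; right<n = right<n
          ; size≤G = subst (suc (right ∸ suc (probe w left right)) ≤_) (G-shift β≤w)
                             (right-part-size inv α≤w (probe<p x≰)) }
      ; unfolds = loop-no l<r α≤w β≤w probe<n x≰ }

  search : ∀ f w left right → w < f → Invariant w left right →
           ∃[ c ] (loop f left right w ≡ just c × c ≤ w)
  search (suc f) w left right w<f inv = continue (left <? right)
    where
    continue : Dec (left < right) → ∃[ c ] (loop (suc f) left right w ≡ just c × c ≤ w)
    continue (no l≮r) = 0 , loop-exit l≮r , z≤n
    continue (yes l<r) =
      let c , runs , c≤ = search f (w ∸ cost) left′ right′ w∸cost<f next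
      in cost + c , trans unfolds (cong (map (_+_ cost)) runs) ,
         ≤-trans (+-monoʳ-≤ cost c≤) (≤-reflexive (m+[n∸m]≡n cost≤w))
      where
      open Step (step f l<r inv)
      w∸cost<f : w ∸ cost < f
      w∸cost<f = <-≤-trans (decrease 1≤cost cost≤w) (s≤s⁻¹ w<f)

proposition7 : (α β n : ℕ) → 1 ≤ α → 1 ≤ β → 1 ≤ n →
    (v : Fin n → ℕ) → (∀ i j → i Fin.< j → v i < v j) →
    (p : Fin n) →
    (k : ℕ) → n ≤ G α β (+ k) → (∀ j → j < k → G α β (+ j) < n) →
    ∃[ fuel ] ∃[ c ] (run α β v (v p) fuel 0 (n ∸ 1) (+ k - + α) ≡ just c
    × c ≤ (α ⊔ β) * ⌈log₂ n ⌉)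
proposition7 α β (suc n) 1≤α 1≤β _ v increasing p k n≤G[k] k-first =
  let c , runs , c≤k = Search.search α β 1≤α 1≤β v increasing p (suc k) k 0 n ≤-refl initial
  in suc k , c , runs , ≤-trans c≤k (Fibonacci.first-index-bound α β 1≤α 1≤β (suc n) k k-first)
  where
  initial : Search.Invariant α β 1≤α 1≤β v increasing p k 0 n
  initial = record
    { left≤p = z≤n ; p≤right = s≤s⁻¹ (FinP.toℕ<n p) ; right<n = ≤-refl ; size≤G = n≤G[k] }
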